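{- Let $a,b,c$ be commuting indeterminates and let $D$ be the derivation of $\mathbb{Q}[a,b,c]$ determined by $D(a)=a^2b^2$, $D(b)=b^3c^2$, $D(c)=b^2c^3$. For $0\le k\le n$ let $T(n,k)=\binom{n+k}{k}\frac{n-k+1}{n+1}$ (the ballot numbers of the Catalan triangle). Then for all $n\ge0$, $$D^n(a^2b^2)=(n+1)!\,a^2b^{2n+2}\sum_{k=0}^nT(n,k)a^{n-k}c^{2k}.$$
   Context: $D$ is the formal derivative of the context-free grammar $\{a\rightarrow a^2b^2, b\rightarrow b^3c^2, c\rightarrow b^2c^3\}$, i.e. a linear map satisfying the Leibniz rule $D(uv)=D(u)v+uD(v)$; $D^0$ is the identity. -}

module Defs where

open import Data.Nat as ℕ using (ℕ; zero; suc; _∸_; _≡ᵇ_; _!)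
open import Data.Nat.Combinatorics using (_C_)
open import Data.Bool using (Bool; true; false; if_then_else_; _∧_)
open import Data.Integer using (+_)
open import Data.Rational using (ℚ; 0ℚ; 1ℚ; _+_; _*_; _/_)
open import Relation.Binary.PropositionalEquality using (_≡_)

ℕ→ℚ : ℕ → ℚ
ℕ→ℚ n = + n / 1

Σℚ : ℕ → (ℕ → ℚ) → ℚ
Σℚ zero    f = f 0
Σℚ (suc n) f = Σℚ n f + f (suc n)

-- Elements of ℚ[a,b,c], represented by their coefficient functions:
-- p i j k is the coefficient of the monomial a^i b^j c^k.
Poly : Set
Poly = ℕ → ℕ → ℕ → ℚ

_≐_ : Poly → Poly → Set
p ≐ q = ∀ i j k → p i j k ≡ q i j k

mon : ℕ → ℕ → ℕ → Poly
mon p q r i j k = if (p ≡ᵇ i) ∧ (q ≡ᵇ j) ∧ (r ≡ᵇ k) then 1ℚ else 0ℚ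

_·_ : ℚ → Poly → Poly
(s · p) i j k = s * p i j k

infixl 6 _⊕_
infixl 7 _⊗_

_⊕_ : Poly → Poly → Poly
(p ⊕ q) i j k = p i j k + q i j k

_⊗_ : Poly → Poly → Poly
(p ⊗ q) i j k =
  Σℚ i (λ x → Σℚ j (λ y → Σℚ k (λ z → p x y z * q (i ∸ x) (j ∸ y) (k ∸ z))))

ΣP : ℕ → (ℕ → Poly) → Poly
ΣP n f i j k = Σℚ n (λ t → f t i j k)

∂a ∂b ∂c : Poly → Poly
∂a p i j k = ℕ→ℚ (suc i) * p (suc i) j k
∂b p i j k = ℕ→ℚ (suc j) * p i (suc j) k
∂c p i j k = ℕ→ℚ (suc k) * p i j (suc k)

-- The derivation D of ℚ[a,b,c] with D a = a²b², D b = b³c², D c = b²c³: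
-- D p = ∂p/∂a · D a + ∂p/∂b · D b + ∂p/∂c · D c
D : Poly → Poly
D p = ∂a p ⊗ mon 2 2 0 ⊕ ∂b p ⊗ mon 0 3 2 ⊕ ∂c p ⊗ mon 0 2 3

D^ : ℕ → Poly → Poly
D^ zero    p = p
D^ (suc n) p = D (D^ n p)

T : ℕ → ℕ → ℚ
T n k = ℕ→ℚ ((n ℕ.+ k) C k) * (+ (suc (n ∸ k)) / suc n)

rhs : ℕ → Poly
rhs n = ℕ→ℚ ((suc n) !) · (mon 2 (2 ℕ.* n ℕ.+ 2) 0 ⊗ ΣP n (λ k → T n k · mon (n ∸ k) 0 (2 ℕ.* k)))

module Submission where

-- Write G(n,k) = (n+1)! T(n,k) = n! C(n+k,k) (n+1-k) ∈ ℕ and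
-- R n = Σ_{k≤n} G(n,k) a^{n-k+2} b^{2n+2} c^{2k}; the theorem says D^n(a²b²) = R n.
-- The proof is an induction on n whose step is D(R n) = R(n+1).  By linearity
-- the step only needs D on a single monomial,
--   D(a^i b^j c^k) = i a^{i+1} b^{j+2} c^k + (j+k) a^i b^{j+2} c^{k+2},
-- after which D(R n) = Σ_k (α_k M_k + β_k M_{k+1}); regrouping by monomials
-- turns the step into the integer recurrence
--   G(n+1,k+1) = (n-k+1) G(n,k+1) + 2(n+k+1) G(n,k),
-- which is checked by clearing factorials.

open import Defs
open import Data.Nat as ℕ using (ℕ; zero; suc; _∸_; _≡ᵇ_; _≤_; z≤n; _!)
import Data.Nat.Properties as ℕP
open import Data.Nat.Combinatorics using (_C_)
open import Relation.Binary.PropositionalEquality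

module Coefficients where

  open import Data.Nat using (_+_; _*_; _/_)
  open import Data.Nat.Properties
  open import Data.Nat.Combinatorics using (nCk≡n!/k![n-k]!; k![n∸k]!∣n!)
  open import Data.Nat.DivMod using (m/n*n≡m)
  import Data.Nat.Solver as ℕSolver
  open import Data.Product using (_,_)
  open ℕSolver.+-*-Solver

  binomial-factorials : ∀ {m k} → k ≤ m → (m C k) * (k ! * (m ∸ k) !) ≡ m !
  binomial-factorials {m} {k} k≤m = begin
      (m C k) * (k ! * (m ∸ k) !)
    ≡⟨ cong (_* (k ! * (m ∸ k) !)) (nCk≡n!/k![n-k]! k≤m) ⟩
      m ! / (k ! * (m ∸ k) !) * (k ! * (m ∸ k) !)
    ≡⟨ m/n*n≡m (k![n∸k]!∣n! k≤m) ⟩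
      m ! ∎
    where
    open ≡-Reasoning
    instance _ = k !* (m ∸ k) !≢0

  -- G n k = (n+1)! T(n,k) for k ≤ n.  The factor suc n ∸ k (rather than
  -- suc (n ∸ k)) makes G n (n+1) vanish, the boundary term of the recurrence.
  G : ℕ → ℕ → ℕ
  G n k = n ! * ((n + k) C k) * (suc n ∸ k)

  G-in-range : ∀ {n k} → k ≤ n → G n k ≡ n ! * ((n + k) C k) * suc (n ∸ k)
  G-in-range {n} {k} k≤n = cong (n ! * ((n + k) C k) *_) (+-∸-assoc 1 k≤n)

  G-factorial : ∀ n k → G n k * k ! ≡ (n + k) ! * (suc n ∸ k)
  G-factorial n k = begin
      n ! * B * s * k !
    ≡⟨ solve 4 (λ f b s g → f :* b :* s :* g := b :* (g :* f) :* s) refl (n !) B s (k !) ⟩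
      B * (k ! * n !) * s
    ≡⟨ cong (λ m → B * (k ! * m !) * s) (sym (m+n∸n≡m n k)) ⟩
      B * (k ! * ((n + k) ∸ k) !) * s
    ≡⟨ cong (_* s) (binomial-factorials (m≤n+m k n)) ⟩
      (n + k) ! * s ∎
    where
    open ≡-Reasoning
    B = (n + k) C k
    s = suc n ∸ k

  G-top : ∀ n → G n (suc n) ≡ 0
  G-top n rewrite n∸n≡0 n = *-zeroʳ (n ! * ((n + suc n) C suc n))

  G-first : ∀ n → G (suc n) 0 ≡ G n 0 * (2 + n)
  G-first n = solve 2 (λ n f → (con 1 :+ n) :* f :* con 1 :* (con 2 :+ n)
                             := f :* con 1 :* (con 1 :+ n) :* (con 2 :+ n)) refl n (n !)

  -- The truncated factor 2 + (n ∸ (k+1)) is wrong only when n = k, where it is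
  -- multiplied by n ∸ k = 0; with n = k + d this is the identity below.
  weight-drop : ∀ k d → d * (2 + ((k + d) ∸ suc k)) ≡ d * suc d
  weight-drop k zero    = refl
  weight-drop k (suc e) =
    cong (λ x → suc e * (2 + x)) (trans (cong (_∸ suc k) (+-suc k e)) (m+n∸m≡n k e))

  -- The recurrence G(n+1,k+1) = (n-k+1) G(n,k+1) + (2n+2+2k) G(n,k) for k ≤ n,
  -- in the form in which its coefficients arise from D.  Both sides are
  -- multiplied by (k+1)! and compared via G-factorial, writing n = k + d.
  G-step : ∀ n k → k ≤ n →
           G n (suc k) * (2 + (n ∸ suc k)) + G n k * (2 * n + 2 + 2 * k) ≡ G (suc n) (suc k)
  G-step n k k≤n with m≤n⇒∃[o]m+o≡n k≤n
  ... | d , refl = *-cancelʳ-≡ _ _ (suc k !) {{suc k !≢0}} (trans expand (sym contract))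
    where
    open ≡-Reasoning
    n′ = k + d
    F = (n′ + k) !
    w = 2 + (n′ ∸ suc k)
    v = 2 * n′ + 2 + 2 * k
    n′∸k≡d : n′ ∸ k ≡ d
    n′∸k≡d = m+n∸m≡n k d
    1+n′∸k≡1+d : suc n′ ∸ k ≡ suc d
    1+n′∸k≡1+d = trans (cong (_∸ k) (sym (+-suc k d))) (m+n∸m≡n k (suc d))
    E = (2 + (n′ + k)) * ((1 + (n′ + k)) * F) * suc d
    contract : G (suc n′) (suc k) * suc k ! ≡ E
    contract = begin
        G (suc n′) (suc k) * suc k !
      ≡⟨ G-factorial (suc n′) (suc k) ⟩
        (suc n′ + suc k) ! * (suc n′ ∸ k)
      ≡⟨ cong₂ (λ m s → suc m ! * s) (+-suc n′ k) 1+n′∸k≡1+d ⟩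
        E ∎
    expand : (G n′ (suc k) * w + G n′ k * v) * suc k ! ≡ E
    expand = begin
        (G n′ (suc k) * w + G n′ k * v) * (suc k * k !)
      ≡⟨ solve 6 (λ a x b y s f → (a :* x :+ b :* y) :* (s :* f) := (a :* (s :* f)) :* x :+ (b :* f) :* (s :* y))
           refl (G n′ (suc k)) w (G n′ k) v (suc k) (k !) ⟩
        G n′ (suc k) * suc k ! * w + G n′ k * k ! * (suc k * v)
      ≡⟨ cong₂ (λ a b → a * w + b * (suc k * v)) (G-factorial n′ (suc k)) (G-factorial n′ k) ⟩
        (n′ + suc k) ! * (n′ ∸ k) * w + F * (suc n′ ∸ k) * (suc k * v)
      ≡⟨ cong₂ _+_ (cong₂ (λ m x → m ! * x * w) (+-suc n′ k) n′∸k≡d)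
                   (cong (λ x → F * x * (suc k * v)) 1+n′∸k≡1+d) ⟩
        suc (n′ + k) ! * d * w + F * suc d * (suc k * v)
      ≡⟨ cong (_+ F * suc d * (suc k * v))
           (trans (*-assoc (suc (n′ + k) !) d w) (cong (suc (n′ + k) ! *_) (weight-drop k d))) ⟩
        suc (n′ + k) ! * (d * suc d) + F * suc d * (suc k * v)
      ≡⟨ solve 3 (λ k d f → (con 1 :+ ((k :+ d) :+ k)) :* f :* (d :* (con 1 :+ d))
                            :+ f :* (con 1 :+ d) :* ((con 1 :+ k) :* (con 2 :* (k :+ d) :+ con 2 :+ con 2 :* k))
                            := (con 2 :+ ((k :+ d) :+ k)) :* ((con 1 :+ ((k :+ d) :+ k)) :* f) :* (con 1 :+ d))
           refl k d F ⟩
        E ∎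

open Coefficients using (G; G-in-range; G-top; G-first; G-step)

open import Data.Bool using (true; false; if_then_else_; _∧_)
open import Data.Empty using (⊥-elim)
open import Data.Integer as ℤ using (+_)
import Data.Integer.Properties as ℤP
open import Data.Rational using (ℚ; 0ℚ; 1ℚ; _+_; _*_; _/_; toℚᵘ)
import Data.Rational.Properties as ℚP
open import Data.Rational.Unnormalised as ℚᵘ using (mkℚᵘ; *≡*)
import Data.Rational.Unnormalised.Properties as ℚᵘP
open import Data.Rational.Solver using (module +-*-Solver)
open import Relation.Binary.Bundles using (Setoid)
import Relation.Binary.Reasoning.Setoid as SetoidReasoning
open import Relation.Nullary using (yes; no)
open +-*-Solver

-- The cast ℕ → ℚ is a semiring homomorphism, and (n+1) · a/(n+1) = a.
-- Each fact is checked in the unnormalised rationals, where it is ring arithmetic.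

toℚᵘ-/ : ∀ a n → toℚᵘ (+ a / suc n) ℚᵘ.≃ mkℚᵘ (+ a) n
toℚᵘ-/ a n = ℚP.toℚᵘ-fromℚᵘ (mkℚᵘ (+ a) n)

ℕ→ℚ-+ : ∀ m n → ℕ→ℚ (m ℕ.+ n) ≡ ℕ→ℚ m + ℕ→ℚ n
ℕ→ℚ-+ m n = ℚP.toℚᵘ-injective (begin
    toℚᵘ (ℕ→ℚ (m ℕ.+ n))               ≈⟨ toℚᵘ-/ (m ℕ.+ n) 0 ⟩
    mkℚᵘ (+ (m ℕ.+ n)) 0               ≈⟨ *≡* (cong (ℤ._* + 1) (trans (ℤP.pos-+ m n)
                                             (sym (cong₂ ℤ._+_ (ℤP.*-identityʳ (+ m)) (ℤP.*-identityʳ (+ n)))))) ⟩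
    mkℚᵘ (+ m) 0 ℚᵘ.+ mkℚᵘ (+ n) 0     ≈⟨ ℚᵘP.+-cong (toℚᵘ-/ m 0) (toℚᵘ-/ n 0) ⟨
    toℚᵘ (ℕ→ℚ m) ℚᵘ.+ toℚᵘ (ℕ→ℚ n)     ≈⟨ ℚP.toℚᵘ-homo-+ (ℕ→ℚ m) (ℕ→ℚ n) ⟨
    toℚᵘ (ℕ→ℚ m + ℕ→ℚ n)               ∎)
  where open SetoidReasoning ℚᵘP.≃-setoid

ℕ→ℚ-* : ∀ m n → ℕ→ℚ (m ℕ.* n) ≡ ℕ→ℚ m * ℕ→ℚ n
ℕ→ℚ-* m n = ℚP.toℚᵘ-injective (begin
    toℚᵘ (ℕ→ℚ (m ℕ.* n))               ≈⟨ toℚᵘ-/ (m ℕ.* n) 0 ⟩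
    mkℚᵘ (+ (m ℕ.* n)) 0               ≈⟨ *≡* (cong (ℤ._* + 1) (ℤP.pos-* m n)) ⟩
    mkℚᵘ (+ m) 0 ℚᵘ.* mkℚᵘ (+ n) 0     ≈⟨ ℚᵘP.*-cong (toℚᵘ-/ m 0) (toℚᵘ-/ n 0) ⟨
    toℚᵘ (ℕ→ℚ m) ℚᵘ.* toℚᵘ (ℕ→ℚ n)     ≈⟨ ℚP.toℚᵘ-homo-* (ℕ→ℚ m) (ℕ→ℚ n) ⟨
    toℚᵘ (ℕ→ℚ m * ℕ→ℚ n)               ∎)
  where open SetoidReasoning ℚᵘP.≃-setoid

ℕ→ℚ-cancel : ∀ n a → ℕ→ℚ (suc n) * (+ a / suc n) ≡ ℕ→ℚ a
ℕ→ℚ-cancel n a = ℚP.toℚᵘ-injective (begin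
    toℚᵘ (ℕ→ℚ (suc n) * (+ a / suc n))         ≈⟨ ℚP.toℚᵘ-homo-* (ℕ→ℚ (suc n)) (+ a / suc n) ⟩
    toℚᵘ (ℕ→ℚ (suc n)) ℚᵘ.* toℚᵘ (+ a / suc n) ≈⟨ ℚᵘP.*-cong (toℚᵘ-/ (suc n) 0) (toℚᵘ-/ a n) ⟩
    mkℚᵘ (+ suc n) 0 ℚᵘ.* mkℚᵘ (+ a) n          ≈⟨ *≡* cross ⟩
    mkℚᵘ (+ a) 0                                 ≈⟨ toℚᵘ-/ a 0 ⟨
    toℚᵘ (ℕ→ℚ a)                                 ∎)
  where
  open SetoidReasoning ℚᵘP.≃-setoid
  cross : (+ suc n ℤ.* + a) ℤ.* + 1 ≡ + a ℤ.* + suc (n ℕ.+ 0)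
  cross = trans (ℤP.*-identityʳ (+ suc n ℤ.* + a))
    (trans (ℤP.*-comm (+ suc n) (+ a)) (cong (λ m → + a ℤ.* + suc m) (sym (ℕP.+-identityʳ n))))

Σ-cong : ∀ n {f g : ℕ → ℚ} → (∀ x → f x ≡ g x) → Σℚ n f ≡ Σℚ n g
Σ-cong zero    f≡g = f≡g 0
Σ-cong (suc n) f≡g = cong₂ _+_ (Σ-cong n f≡g) (f≡g (suc n))

Σ-cong-≤ : ∀ n {f g : ℕ → ℚ} → (∀ x → x ≤ n → f x ≡ g x) → Σℚ n f ≡ Σℚ n g
Σ-cong-≤ zero    f≡g = f≡g 0 z≤n
Σ-cong-≤ (suc n) f≡g =
  cong₂ _+_ (Σ-cong-≤ n (λ x x≤n → f≡g x (ℕP.m≤n⇒m≤1+n x≤n))) (f≡g (suc n) ℕP.≤-refl)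

Σ-+ : ∀ n (f g : ℕ → ℚ) → Σℚ n (λ x → f x + g x) ≡ Σℚ n f + Σℚ n g
Σ-+ zero    f g = refl
Σ-+ (suc n) f g = trans (cong (_+ (f (suc n) + g (suc n))) (Σ-+ n f g))
  (solve 4 (λ a b c d → (a :+ b) :+ (c :+ d) := (a :+ c) :+ (b :+ d)) refl
     (Σℚ n f) (Σℚ n g) (f (suc n)) (g (suc n)))

Σ-*ˡ : ∀ n c (f : ℕ → ℚ) → Σℚ n (λ x → c * f x) ≡ c * Σℚ n f
Σ-*ˡ zero    c f = refl
Σ-*ˡ (suc n) c f =
  trans (cong (_+ c * f (suc n)) (Σ-*ˡ n c f)) (sym (ℚP.*-distribˡ-+ c (Σℚ n f) (f (suc n))))

Σ-*ʳ : ∀ n c (f : ℕ → ℚ) → Σℚ n (λ x → f x * c) ≡ Σℚ n f * c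
Σ-*ʳ n c f = trans (Σ-cong n (λ x → ℚP.*-comm (f x) c)) (trans (Σ-*ˡ n c f) (ℚP.*-comm c (Σℚ n f)))

Σ-zero : ∀ n {f : ℕ → ℚ} → (∀ x → f x ≡ 0ℚ) → Σℚ n f ≡ 0ℚ
Σ-zero zero    f≡0 = f≡0 0
Σ-zero (suc n) f≡0 = cong₂ _+_ (Σ-zero n f≡0) (f≡0 (suc n))

Σ-peel : ∀ n (f : ℕ → ℚ) → Σℚ (suc n) f ≡ f 0 + Σℚ n (λ x → f (suc x))
Σ-peel zero    f = refl
Σ-peel (suc n) f = trans (cong (_+ f (suc (suc n))) (Σ-peel n f)) (ℚP.+-assoc (f 0) _ _)

-- Regrouping Σ_k (α_k M_k + β_k M_{k+1}) by the M's; with α_{n+1} = 0 this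
-- collects D(R n) into the monomials of R(n+1).
Σ-telescope : ∀ n (α β M : ℕ → ℚ) →
  Σℚ n (λ k → α k * M k + β k * M (suc k)) + α (suc n) * M (suc n) ≡
  α 0 * M 0 + Σℚ n (λ k → (α (suc k) + β k) * M (suc k))
Σ-telescope zero α β M =
  solve 5 (λ a₀ m₀ b₀ m₁ a₁ → (a₀ :* m₀ :+ b₀ :* m₁) :+ a₁ :* m₁ := a₀ :* m₀ :+ (a₁ :+ b₀) :* m₁)
    refl (α 0) (M 0) (β 0) (M 1) (α 1)
Σ-telescope (suc n) α β M = begin
    (S + (α (suc n) * M (suc n) + β (suc n) * M (suc (suc n)))) + α (suc (suc n)) * M (suc (suc n))
  ≡⟨ solve 6 (λ s a m b m′ a′ → (s :+ (a :* m :+ b :* m′)) :+ a′ :* m′ := (s :+ a :* m) :+ (a′ :+ b) :* m′)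
       refl S (α (suc n)) (M (suc n)) (β (suc n)) (M (suc (suc n))) (α (suc (suc n))) ⟩
    (S + α (suc n) * M (suc n)) + (α (suc (suc n)) + β (suc n)) * M (suc (suc n))
  ≡⟨ cong (_+ (α (suc (suc n)) + β (suc n)) * M (suc (suc n))) (Σ-telescope n α β M) ⟩
    (α 0 * M 0 + Σℚ n (λ k → (α (suc k) + β k) * M (suc k))) + (α (suc (suc n)) + β (suc n)) * M (suc (suc n))
  ≡⟨ ℚP.+-assoc (α 0 * M 0) _ _ ⟩
    α 0 * M 0 + Σℚ (suc n) (λ k → (α (suc k) + β k) * M (suc k)) ∎
  where
  open ≡-Reasoning
  S = Σℚ n (λ k → α k * M k + β k * M (suc k))

-- Kronecker deltas.  The monomial a^p b^q c^r is the product δ_p δ_q δ_r of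
-- deltas in the three exponents, which reduces products and derivatives of
-- monomials to one-variable facts about δ.

δ : ℕ → ℕ → ℚ
δ a b = if a ≡ᵇ b then 1ℚ else 0ℚ

δ-off : ∀ a b → a ≢ b → δ a b ≡ 0ℚ
δ-off a b a≢b with a ≡ᵇ b | ℕP.≡ᵇ⇒≡ a b
... | false | _     = refl
... | true  | a≡ᵇb = ⊥-elim (a≢b (a≡ᵇb _))

δ-weight : ∀ (w : ℕ → ℚ) a b → w b * δ a b ≡ w a * δ a b
δ-weight w a b with a ℕP.≟ b
... | yes refl = refl
... | no a≢b   = trans (cong (w b *_) (δ-off a b a≢b))
                   (trans (ℚP.*-zeroʳ (w b)) (sym (trans (cong (w a *_) (δ-off a b a≢b)) (ℚP.*-zeroʳ (w a)))))

δ-conv : ∀ p s i → Σℚ i (λ x → δ p x * δ s (i ∸ x)) ≡ δ (p ℕ.+ s) i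
δ-conv zero    s zero    = ℚP.*-identityˡ (δ s 0)
δ-conv zero    s (suc i) = begin
    Σℚ (suc i) (λ x → δ 0 x * δ s (suc i ∸ x))
  ≡⟨ Σ-peel i _ ⟩
    1ℚ * δ s (suc i) + Σℚ i (λ x → 0ℚ * δ s (i ∸ x))
  ≡⟨ cong₂ _+_ (ℚP.*-identityˡ (δ s (suc i))) (Σ-zero i (λ x → ℚP.*-zeroˡ (δ s (i ∸ x)))) ⟩
    δ s (suc i) + 0ℚ
  ≡⟨ ℚP.+-identityʳ (δ s (suc i)) ⟩
    δ s (suc i) ∎
  where open ≡-Reasoning
δ-conv (suc p) s zero    = ℚP.*-zeroˡ (δ s 0)
δ-conv (suc p) s (suc i) = begin
    Σℚ (suc i) (λ x → δ (suc p) x * δ s (suc i ∸ x))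
  ≡⟨ Σ-peel i _ ⟩
    0ℚ * δ s (suc i) + Σℚ i (λ x → δ p x * δ s (i ∸ x))
  ≡⟨ cong₂ _+_ (ℚP.*-zeroˡ (δ s (suc i))) (δ-conv p s i) ⟩
    0ℚ + δ (p ℕ.+ s) i
  ≡⟨ ℚP.+-identityˡ (δ (p ℕ.+ s) i) ⟩
    δ (p ℕ.+ s) i ∎
  where open ≡-Reasoning

if-∧ : ∀ a b → (if a ∧ b then 1ℚ else 0ℚ) ≡ (if a then 1ℚ else 0ℚ) * (if b then 1ℚ else 0ℚ)
if-∧ true  b = sym (ℚP.*-identityˡ (if b then 1ℚ else 0ℚ))
if-∧ false b = sym (ℚP.*-zeroˡ (if b then 1ℚ else 0ℚ))

mon-δ : ∀ p q r x y z → mon p q r x y z ≡ δ p x * (δ q y * δ r z)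
mon-δ p q r x y z = trans (if-∧ (p ≡ᵇ x) _) (cong (δ p x *_) (if-∧ (q ≡ᵇ y) (r ≡ᵇ z)))

mon-δ-b : ∀ p q r x y z → mon p q r x y z ≡ δ q y * (δ p x * δ r z)
mon-δ-b p q r x y z = trans (mon-δ p q r x y z)
  (solve 3 (λ a b c → a :* (b :* c) := b :* (a :* c)) refl (δ p x) (δ q y) (δ r z))

mon-δ-c : ∀ p q r x y z → mon p q r x y z ≡ δ r z * (δ p x * δ q y)
mon-δ-c p q r x y z = trans (mon-δ p q r x y z)
  (solve 3 (λ a b c → a :* (b :* c) := c :* (a :* b)) refl (δ p x) (δ q y) (δ r z))

≐-refl : ∀ {p} → p ≐ p
≐-refl i j k = refl

≐-sym : ∀ {p q} → p ≐ q → q ≐ p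
≐-sym p≐q i j k = sym (p≐q i j k)

≐-trans : ∀ {p q r} → p ≐ q → q ≐ r → p ≐ r
≐-trans p≐q q≐r i j k = trans (p≐q i j k) (q≐r i j k)

≐-setoid : Setoid _ _
≐-setoid = record
  { Carrier       = Poly
  ; _≈_           = _≐_
  ; isEquivalence = record { refl = ≐-refl ; sym = ≐-sym ; trans = ≐-trans }
  }

module ≐-Reasoning = SetoidReasoning ≐-setoid

0ₚ : Poly
0ₚ _ _ _ = 0ℚ

mon-cong : ∀ {p p′ q q′ r r′} → p ≡ p′ → q ≡ q′ → r ≡ r′ → mon p q r ≐ mon p′ q′ r′
mon-cong refl refl refl = ≐-refl

⊕-cong : ∀ {p p′ q q′} → p ≐ p′ → q ≐ q′ → (p ⊕ q) ≐ (p′ ⊕ q′)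
⊕-cong p≐p′ q≐q′ i j k = cong₂ _+_ (p≐p′ i j k) (q≐q′ i j k)

⊕-assoc : ∀ p q r → (p ⊕ q ⊕ r) ≐ (p ⊕ (q ⊕ r))
⊕-assoc p q r i j k = ℚP.+-assoc (p i j k) (q i j k) (r i j k)

·-cong : ∀ c {p q} → p ≐ q → (c · p) ≐ (c · q)
·-cong c p≐q i j k = cong (c *_) (p≐q i j k)

·-congˡ : ∀ {c d} p → c ≡ d → (c · p) ≐ (d · p)
·-congˡ p refl = ≐-refl

·-assoc : ∀ c d p → (c · (d · p)) ≐ ((c * d) · p)
·-assoc c d p i j k = sym (ℚP.*-assoc c d (p i j k))

·-distrib : ∀ c d p → ((c · p) ⊕ (d · p)) ≐ ((c + d) · p)
·-distrib c d p i j k = sym (ℚP.*-distribʳ-+ (p i j k) c d)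

·-zero : ∀ {c} p → c ≡ 0ℚ → (c · p) ≐ 0ₚ
·-zero p refl i j k = ℚP.*-zeroˡ (p i j k)

ΣP-cong-≤ : ∀ n {f g : ℕ → Poly} → (∀ t → t ≤ n → f t ≐ g t) → ΣP n f ≐ ΣP n g
ΣP-cong-≤ n f≐g i j k = Σ-cong-≤ n (λ t t≤n → f≐g t t≤n i j k)

·-ΣP : ∀ n c (f : ℕ → Poly) → (c · ΣP n f) ≐ ΣP n (λ t → c · f t)
·-ΣP n c f i j k = sym (Σ-*ˡ n c (λ t → f t i j k))

Σ³ : ℕ → ℕ → ℕ → (ℕ → ℕ → ℕ → ℚ) → ℚ
Σ³ i j k f = Σℚ i (λ x → Σℚ j (λ y → Σℚ k (λ z → f x y z)))

Σ³-cong : ∀ i j k {f g : ℕ → ℕ → ℕ → ℚ} → (∀ x y z → f x y z ≡ g x y z) → Σ³ i j k f ≡ Σ³ i j k g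
Σ³-cong i j k f≡g = Σ-cong i (λ x → Σ-cong j (λ y → Σ-cong k (f≡g x y)))

Σ³-+ : ∀ i j k (f g : ℕ → ℕ → ℕ → ℚ) →
       Σ³ i j k (λ x y z → f x y z + g x y z) ≡ Σ³ i j k f + Σ³ i j k g
Σ³-+ i j k f g =
  trans (Σ-cong i (λ x → trans (Σ-cong j (λ y → Σ-+ k (f x y) (g x y))) (Σ-+ j _ _))) (Σ-+ i _ _)

Σ³-*ˡ : ∀ i j k c (f : ℕ → ℕ → ℕ → ℚ) → Σ³ i j k (λ x y z → c * f x y z) ≡ c * Σ³ i j k f
Σ³-*ˡ i j k c f =
  trans (Σ-cong i (λ x → trans (Σ-cong j (λ y → Σ-*ˡ k c (f x y))) (Σ-*ˡ j c _))) (Σ-*ˡ i c _)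

Σ³-zero : ∀ i j k {f : ℕ → ℕ → ℕ → ℚ} → (∀ x y z → f x y z ≡ 0ℚ) → Σ³ i j k f ≡ 0ℚ
Σ³-zero i j k f≡0 = Σ-zero i (λ x → Σ-zero j (λ y → Σ-zero k (f≡0 x y)))

Σ³-separate : ∀ i j k (f g h : ℕ → ℚ) →
              Σ³ i j k (λ x y z → f x * (g y * h z)) ≡ Σℚ i f * (Σℚ j g * Σℚ k h)
Σ³-separate i j k f g h = begin
    Σ³ i j k (λ x y z → f x * (g y * h z))
  ≡⟨ Σ-cong i (λ x → Σ-cong j (λ y → trans (Σ-*ˡ k (f x) _) (cong (f x *_) (Σ-*ˡ k (g y) h)))) ⟩
    Σℚ i (λ x → Σℚ j (λ y → f x * (g y * Σℚ k h)))
  ≡⟨ Σ-cong i (λ x → trans (Σ-*ˡ j (f x) _) (cong (f x *_) (Σ-*ʳ j (Σℚ k h) g))) ⟩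
    Σℚ i (λ x → f x * (Σℚ j g * Σℚ k h))
  ≡⟨ Σ-*ʳ i _ f ⟩
    Σℚ i f * (Σℚ j g * Σℚ k h) ∎
  where open ≡-Reasoning

⊗-congˡ : ∀ {p p′} q → p ≐ p′ → (p ⊗ q) ≐ (p′ ⊗ q)
⊗-congˡ q p≐p′ i j k = Σ³-cong i j k (λ x y z → cong (_* q (i ∸ x) (j ∸ y) (k ∸ z)) (p≐p′ x y z))

⊗-distribʳ : ∀ p q r → ((p ⊕ q) ⊗ r) ≐ (p ⊗ r ⊕ q ⊗ r)
⊗-distribʳ p q r i j k = trans
  (Σ³-cong i j k (λ x y z → ℚP.*-distribʳ-+ (r (i ∸ x) (j ∸ y) (k ∸ z)) (p x y z) (q x y z)))
  (Σ³-+ i j k _ _)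

⊗-distribˡ : ∀ r p q → (r ⊗ (p ⊕ q)) ≐ (r ⊗ p ⊕ r ⊗ q)
⊗-distribˡ r p q i j k = trans
  (Σ³-cong i j k (λ x y z → ℚP.*-distribˡ-+ (r x y z) (p (i ∸ x) (j ∸ y) (k ∸ z)) _))
  (Σ³-+ i j k _ _)

⊗-zeroˡ : ∀ {p} q → p ≐ 0ₚ → (p ⊗ q) ≐ 0ₚ
⊗-zeroˡ q p≐0 i j k = Σ³-zero i j k (λ x y z →
  trans (cong (_* q (i ∸ x) (j ∸ y) (k ∸ z)) (p≐0 x y z)) (ℚP.*-zeroˡ (q (i ∸ x) (j ∸ y) (k ∸ z))))

·-⊗ : ∀ c p q → ((c · p) ⊗ q) ≐ (c · (p ⊗ q))
·-⊗ c p q i j k = trans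
  (Σ³-cong i j k (λ x y z → ℚP.*-assoc c (p x y z) _))
  (Σ³-*ˡ i j k c _)

⊗-· : ∀ p c q → (p ⊗ (c · q)) ≐ (c · (p ⊗ q))
⊗-· p c q i j k = trans
  (Σ³-cong i j k (λ x y z → solve 3 (λ a c b → a :* (c :* b) := c :* (a :* b)) refl (p x y z) c _))
  (Σ³-*ˡ i j k c _)

⊗-ΣP : ∀ n r (f : ℕ → Poly) → (r ⊗ ΣP n f) ≐ ΣP n (λ t → r ⊗ f t)
⊗-ΣP zero    r f = ≐-refl
⊗-ΣP (suc n) r f = ≐-trans (⊗-distribˡ r (ΣP n f) (f (suc n))) (⊕-cong (⊗-ΣP n r f) ≐-refl)

mon-⊗ : ∀ p q r s t u → (mon p q r ⊗ mon s t u) ≐ mon (p ℕ.+ s) (q ℕ.+ t) (r ℕ.+ u)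
mon-⊗ p q r s t u i j k = begin
    (mon p q r ⊗ mon s t u) i j k
  ≡⟨ Σ³-cong i j k (λ x y z → trans (cong₂ _*_ (mon-δ p q r x y z) (mon-δ s t u _ _ _))
       (solve 6 (λ a b c a′ b′ c′ → (a :* (b :* c)) :* (a′ :* (b′ :* c′)) := (a :* a′) :* ((b :* b′) :* (c :* c′)))
          refl (δ p x) (δ q y) (δ r z) (δ s (i ∸ x)) (δ t (j ∸ y)) (δ u (k ∸ z)))) ⟩
    Σ³ i j k (λ x y z → (δ p x * δ s (i ∸ x)) * ((δ q y * δ t (j ∸ y)) * (δ r z * δ u (k ∸ z))))
  ≡⟨ Σ³-separate i j k _ _ _ ⟩
    Σℚ i (λ x → δ p x * δ s (i ∸ x)) * (Σℚ j (λ y → δ q y * δ t (j ∸ y)) * Σℚ k (λ z → δ r z * δ u (k ∸ z)))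
  ≡⟨ cong₂ _*_ (δ-conv p s i) (cong₂ _*_ (δ-conv q t j) (δ-conv r u k)) ⟩
    δ (p ℕ.+ s) i * (δ (q ℕ.+ t) j * δ (r ℕ.+ u) k)
  ≡⟨ sym (mon-δ (p ℕ.+ s) (q ℕ.+ t) (r ℕ.+ u) i j k) ⟩
    mon (p ℕ.+ s) (q ℕ.+ t) (r ℕ.+ u) i j k ∎
  where open ≡-Reasoning

scaled-mon-⊗ : ∀ c p q r s t u {p′ q′ r′} → p ℕ.+ s ≡ p′ → q ℕ.+ t ≡ q′ → r ℕ.+ u ≡ r′ →
               ((c · mon p q r) ⊗ mon s t u) ≐ (c · mon p′ q′ r′)
scaled-mon-⊗ c p q r s t u e₁ e₂ e₃ =
  ≐-trans (·-⊗ c (mon p q r) (mon s t u))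
          (·-cong c (≐-trans (mon-⊗ p q r s t u) (mon-cong e₁ e₂ e₃)))

-- A coefficient ∂x produces
-- at exponent e is (e+1) times the coefficient at e+1; against the delta of
-- that coordinate the weight e+1 may be read off at the monomial's exponent.

coordinate-weight : ∀ (w : ℕ → ℚ) c a b u {m} → m ≡ δ a b * u → w b * (c * m) ≡ (c * w a) * m
coordinate-weight w c a b u refl = begin
    w b * (c * (δ a b * u))
  ≡⟨ solve 4 (λ w c d u → w :* (c :* (d :* u)) := c :* ((w :* d) :* u)) refl (w b) c (δ a b) u ⟩
    c * ((w b * δ a b) * u)
  ≡⟨ cong (λ t → c * (t * u)) (δ-weight w a b) ⟩
    c * ((w a * δ a b) * u)
  ≡⟨ solve 4 (λ w c d u → c :* ((w :* d) :* u) := (c :* w) :* (d :* u)) refl (w a) c (δ a b) u ⟩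
    (c * w a) * (δ a b * u) ∎
  where open ≡-Reasoning

absent-coordinate : ∀ e c u {m} → m ≡ 0ℚ * u → e * (c * m) ≡ 0ℚ
absent-coordinate e c u refl = begin
    e * (c * (0ℚ * u))  ≡⟨ cong (λ t → e * (c * t)) (ℚP.*-zeroˡ u) ⟩
    e * (c * 0ℚ)        ≡⟨ cong (e *_) (ℚP.*-zeroʳ c) ⟩
    e * 0ℚ              ≡⟨ ℚP.*-zeroʳ e ⟩
    0ℚ                  ∎
  where open ≡-Reasoning

1+ : ℕ → ℚ
1+ e = ℕ→ℚ (suc e)

∂a-mon : ∀ c i j k → ∂a (c · mon (suc i) j k) ≐ ((c * ℕ→ℚ (suc i)) · mon i j k)
∂a-mon c i j k x y z = coordinate-weight 1+ c i x (δ j y * δ k z) (mon-δ i j k x y z)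

∂b-mon : ∀ c i j k → ∂b (c · mon i (suc j) k) ≐ ((c * ℕ→ℚ (suc j)) · mon i j k)
∂b-mon c i j k x y z = coordinate-weight 1+ c j y (δ i x * δ k z) (mon-δ-b i j k x y z)

∂c-mon : ∀ c i j k → ∂c (c · mon i j (suc k)) ≐ ((c * ℕ→ℚ (suc k)) · mon i j k)
∂c-mon c i j k x y z = coordinate-weight 1+ c k z (δ i x * δ j y) (mon-δ-c i j k x y z)

∂a-mon-0 : ∀ c j k → ∂a (c · mon 0 j k) ≐ 0ₚ
∂a-mon-0 c j k x y z = absent-coordinate (1+ x) c (δ j y * δ k z) (mon-δ 0 j k (suc x) y z)

∂b-mon-0 : ∀ c i k → ∂b (c · mon i 0 k) ≐ 0ₚ
∂b-mon-0 c i k x y z = absent-coordinate (1+ y) c (δ i x * δ k z) (mon-δ-b i 0 k x (suc y) z)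

∂c-mon-0 : ∀ c i j → ∂c (c · mon i j 0) ≐ 0ₚ
∂c-mon-0 c i j x y z = absent-coordinate (1+ z) c (δ i x * δ j y) (mon-δ-c i j 0 x y (suc z))

vanishing-term : ∀ {p} c q r → p ≐ 0ₚ → (p ⊗ q) ≐ ((c * ℕ→ℚ 0) · r)
vanishing-term c q r p≐0 = ≐-trans (⊗-zeroˡ q p≐0) (≐-sym (·-zero r (ℚP.*-zeroʳ c)))

a-term : ∀ c i j k → (∂a (c · mon i j k) ⊗ mon 2 2 0) ≐ ((c * ℕ→ℚ i) · mon (suc i) (2 ℕ.+ j) k)
a-term c zero    j k = vanishing-term c (mon 2 2 0) (mon 1 (2 ℕ.+ j) k) (∂a-mon-0 c j k)
a-term c (suc i) j k = ≐-trans (⊗-congˡ (mon 2 2 0) (∂a-mon c i j k))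
  (scaled-mon-⊗ (c * ℕ→ℚ (suc i)) i j k 2 2 0 (ℕP.+-comm i 2) (ℕP.+-comm j 2) (ℕP.+-identityʳ k))

b-term : ∀ c i j k → (∂b (c · mon i j k) ⊗ mon 0 3 2) ≐ ((c * ℕ→ℚ j) · mon i (2 ℕ.+ j) (2 ℕ.+ k))
b-term c i zero    k = vanishing-term c (mon 0 3 2) (mon i 2 (2 ℕ.+ k)) (∂b-mon-0 c i k)
b-term c i (suc j) k = ≐-trans (⊗-congˡ (mon 0 3 2) (∂b-mon c i j k))
  (scaled-mon-⊗ (c * ℕ→ℚ (suc j)) i j k 0 3 2 (ℕP.+-identityʳ i) (ℕP.+-comm j 3) (ℕP.+-comm k 2))

c-term : ∀ c i j k → (∂c (c · mon i j k) ⊗ mon 0 2 3) ≐ ((c * ℕ→ℚ k) · mon i (2 ℕ.+ j) (2 ℕ.+ k))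
c-term c i j zero    = vanishing-term c (mon 0 2 3) (mon i (2 ℕ.+ j) 2) (∂c-mon-0 c i j)
c-term c i j (suc k) = ≐-trans (⊗-congˡ (mon 0 2 3) (∂c-mon c i j k))
  (scaled-mon-⊗ (c * ℕ→ℚ (suc k)) i j k 0 2 3 (ℕP.+-identityʳ i) (ℕP.+-comm j 2) (ℕP.+-comm k 3))

D-mon : ∀ c i j k → D (c · mon i j k) ≐
        ((c * ℕ→ℚ i) · mon (suc i) (2 ℕ.+ j) k ⊕ (c * ℕ→ℚ (j ℕ.+ k)) · mon i (2 ℕ.+ j) (2 ℕ.+ k))
D-mon c i j k = begin
    D (c · mon i j k)
  ≈⟨ ⊕-cong (⊕-cong (a-term c i j k) (b-term c i j k)) (c-term c i j k) ⟩
    aTerm ⊕ (c * ℕ→ℚ j) · B ⊕ (c * ℕ→ℚ k) · B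
  ≈⟨ ⊕-assoc aTerm ((c * ℕ→ℚ j) · B) ((c * ℕ→ℚ k) · B) ⟩
    aTerm ⊕ ((c * ℕ→ℚ j) · B ⊕ (c * ℕ→ℚ k) · B)
  ≈⟨ ⊕-cong (≐-refl {aTerm}) (·-distrib (c * ℕ→ℚ j) (c * ℕ→ℚ k) B) ⟩
    aTerm ⊕ (c * ℕ→ℚ j + c * ℕ→ℚ k) · B
  ≈⟨ ⊕-cong (≐-refl {aTerm}) (·-congˡ B (trans (sym (ℚP.*-distribˡ-+ c _ _)) (cong (c *_) (sym (ℕ→ℚ-+ j k))))) ⟩
    aTerm ⊕ (c * ℕ→ℚ (j ℕ.+ k)) · B ∎
  where
  open ≐-Reasoning
  B = mon i (2 ℕ.+ j) (2 ℕ.+ k)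
  aTerm = (c * ℕ→ℚ i) · mon (suc i) (2 ℕ.+ j) k

∂a-cong : ∀ {p q} → p ≐ q → ∂a p ≐ ∂a q
∂a-cong p≐q i j k = cong (ℕ→ℚ (suc i) *_) (p≐q (suc i) j k)

∂b-cong : ∀ {p q} → p ≐ q → ∂b p ≐ ∂b q
∂b-cong p≐q i j k = cong (ℕ→ℚ (suc j) *_) (p≐q i (suc j) k)

∂c-cong : ∀ {p q} → p ≐ q → ∂c p ≐ ∂c q
∂c-cong p≐q i j k = cong (ℕ→ℚ (suc k) *_) (p≐q i j (suc k))

∂a-⊕ : ∀ p q → ∂a (p ⊕ q) ≐ (∂a p ⊕ ∂a q)
∂a-⊕ p q i j k = ℚP.*-distribˡ-+ (ℕ→ℚ (suc i)) (p (suc i) j k) (q (suc i) j k)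

∂b-⊕ : ∀ p q → ∂b (p ⊕ q) ≐ (∂b p ⊕ ∂b q)
∂b-⊕ p q i j k = ℚP.*-distribˡ-+ (ℕ→ℚ (suc j)) (p i (suc j) k) (q i (suc j) k)

∂c-⊕ : ∀ p q → ∂c (p ⊕ q) ≐ (∂c p ⊕ ∂c q)
∂c-⊕ p q i j k = ℚP.*-distribˡ-+ (ℕ→ℚ (suc k)) (p i j (suc k)) (q i j (suc k))

D-cong : ∀ {p q} → p ≐ q → D p ≐ D q
D-cong p≐q = ⊕-cong (⊕-cong (⊗-congˡ (mon 2 2 0) (∂a-cong p≐q)) (⊗-congˡ (mon 0 3 2) (∂b-cong p≐q)))
                    (⊗-congˡ (mon 0 2 3) (∂c-cong p≐q))

D-⊕ : ∀ p q → D (p ⊕ q) ≐ (D p ⊕ D q)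
D-⊕ p q = ≐-trans
  (⊕-cong (⊕-cong (term (mon 2 2 0) (∂a p) (∂a q) (∂a-⊕ p q)) (term (mon 0 3 2) (∂b p) (∂b q) (∂b-⊕ p q)))
          (term (mon 0 2 3) (∂c p) (∂c q) (∂c-⊕ p q)))
  (λ i j k → solve 6 (λ a a′ b b′ c c′ → ((a :+ a′) :+ (b :+ b′)) :+ (c :+ c′) := ((a :+ b) :+ c) :+ ((a′ :+ b′) :+ c′))
               refl (A₁ i j k) (A₂ i j k) (B₁ i j k) (B₂ i j k) (C₁ i j k) (C₂ i j k))
  where
  term : ∀ {r} m s t → r ≐ (s ⊕ t) → (r ⊗ m) ≐ (s ⊗ m ⊕ t ⊗ m)
  term m s t r≐s⊕t = ≐-trans (⊗-congˡ m r≐s⊕t) (⊗-distribʳ s t m)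
  A₁ = ∂a p ⊗ mon 2 2 0
  A₂ = ∂a q ⊗ mon 2 2 0
  B₁ = ∂b p ⊗ mon 0 3 2
  B₂ = ∂b q ⊗ mon 0 3 2
  C₁ = ∂c p ⊗ mon 0 2 3
  C₂ = ∂c q ⊗ mon 0 2 3

D-ΣP : ∀ n (f : ℕ → Poly) → D (ΣP n f) ≐ ΣP n (λ t → D (f t))
D-ΣP zero    f = ≐-refl
D-ΣP (suc n) f = ≐-trans (D-⊕ (ΣP n f) (f (suc n))) (⊕-cong (D-ΣP n f) ≐-refl)

R : ℕ → Poly
R n = ΣP n (λ k → ℕ→ℚ (G n k) · mon (2 ℕ.+ (n ∸ k)) (2 ℕ.* n ℕ.+ 2) (2 ℕ.* k))

b-shift : ∀ n → 2 ℕ.+ (2 ℕ.* n ℕ.+ 2) ≡ 2 ℕ.* suc n ℕ.+ 2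
b-shift n = trans (sym (ℕP.+-assoc 2 (2 ℕ.* n) 2)) (cong (ℕ._+ 2) (sym (ℕP.*-suc 2 n)))

c-shift : ∀ k → 2 ℕ.+ 2 ℕ.* k ≡ 2 ℕ.* suc k
c-shift k = sym (ℕP.*-suc 2 k)

-- Term k of R n contributes α_k M_k + β_k M_{k+1},
-- where M_k is the k-th monomial of R(n+1); the coefficients then telescope
-- into those of R(n+1) by the recurrence for G.
module Recurrence (n : ℕ) where

  b : ℕ
  b = 2 ℕ.* n ℕ.+ 2

  g α β γ : ℕ → ℚ
  g k = ℕ→ℚ (G n k)
  α k = g k * ℕ→ℚ (2 ℕ.+ (n ∸ k))
  β k = g k * ℕ→ℚ (b ℕ.+ 2 ℕ.* k)
  γ k = ℕ→ℚ (G (suc n) k)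

  M : ℕ → Poly
  M k = mon (2 ℕ.+ (suc n ∸ k)) (2 ℕ.* suc n ℕ.+ 2) (2 ℕ.* k)

  D-term : ∀ k → k ≤ n → D (g k · mon (2 ℕ.+ (n ∸ k)) b (2 ℕ.* k)) ≐ (α k · M k ⊕ β k · M (suc k))
  D-term k k≤n = ≐-trans (D-mon (g k) (2 ℕ.+ (n ∸ k)) b (2 ℕ.* k))
    (⊕-cong (·-cong (α k) (mon-cong (cong (2 ℕ.+_) (sym (ℕP.+-∸-assoc 1 k≤n))) (b-shift n) (refl {x = 2 ℕ.* k})))
            (·-cong (β k) (mon-cong (refl {x = 2 ℕ.+ (n ∸ k)}) (b-shift n) (c-shift k))))

  first : α 0 ≡ γ 0
  first = trans (sym (ℕ→ℚ-* (G n 0) (2 ℕ.+ n))) (cong ℕ→ℚ (sym (G-first n)))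

  step : ∀ k → k ≤ n → α (suc k) + β k ≡ γ (suc k)
  step k k≤n = begin
      g (suc k) * ℕ→ℚ (2 ℕ.+ (n ∸ suc k)) + g k * ℕ→ℚ (b ℕ.+ 2 ℕ.* k)
    ≡⟨ cong₂ _+_ (sym (ℕ→ℚ-* (G n (suc k)) _)) (sym (ℕ→ℚ-* (G n k) _)) ⟩
      ℕ→ℚ (G n (suc k) ℕ.* (2 ℕ.+ (n ∸ suc k))) + ℕ→ℚ (G n k ℕ.* (b ℕ.+ 2 ℕ.* k))
    ≡⟨ sym (ℕ→ℚ-+ (G n (suc k) ℕ.* (2 ℕ.+ (n ∸ suc k))) (G n k ℕ.* (b ℕ.+ 2 ℕ.* k))) ⟩
      ℕ→ℚ (G n (suc k) ℕ.* (2 ℕ.+ (n ∸ suc k)) ℕ.+ G n k ℕ.* (b ℕ.+ 2 ℕ.* k))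
    ≡⟨ cong ℕ→ℚ (G-step n k k≤n) ⟩
      γ (suc k) ∎
    where open ≡-Reasoning

  last : α (suc n) ≡ 0ℚ
  last = trans (cong (λ m → ℕ→ℚ m * ℕ→ℚ (2 ℕ.+ (n ∸ suc n))) (G-top n)) (ℚP.*-zeroˡ (ℕ→ℚ (2 ℕ.+ (n ∸ suc n))))

  telescoped : ΣP n (λ k → α k · M k ⊕ β k · M (suc k)) ≐ R (suc n)
  telescoped x y z = begin
      S
    ≡⟨ sym (ℚP.+-identityʳ S) ⟩
      S + 0ℚ
    ≡⟨ cong (λ t → S + t) (sym (trans (cong (_* m (suc n)) last) (ℚP.*-zeroˡ (m (suc n))))) ⟩
      S + α (suc n) * m (suc n)
    ≡⟨ Σ-telescope n α β m ⟩
      α 0 * m 0 + Σℚ n (λ k → (α (suc k) + β k) * m (suc k))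
    ≡⟨ cong₂ _+_ (cong (_* m 0) first) (Σ-cong-≤ n (λ k k≤n → cong (_* m (suc k)) (step k k≤n))) ⟩
      γ 0 * m 0 + Σℚ n (λ k → γ (suc k) * m (suc k))
    ≡⟨ sym (Σ-peel n (λ k → γ k * m k)) ⟩
      R (suc n) x y z ∎
    where
    open ≡-Reasoning
    m : ℕ → ℚ
    m k = M k x y z
    S = Σℚ n (λ k → α k * m k + β k * m (suc k))

  D-R : D (R n) ≐ R (suc n)
  D-R = begin
      D (R n)
    ≈⟨ D-ΣP n (λ k → g k · mon (2 ℕ.+ (n ∸ k)) b (2 ℕ.* k)) ⟩
      ΣP n (λ k → D (g k · mon (2 ℕ.+ (n ∸ k)) b (2 ℕ.* k)))
    ≈⟨ ΣP-cong-≤ n D-term ⟩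
      ΣP n (λ k → α k · M k ⊕ β k · M (suc k))
    ≈⟨ telescoped ⟩
      R (suc n) ∎
    where open ≐-Reasoning

open Recurrence using (D-R)

factorial-T : ∀ {n k} → k ≤ n → ℕ→ℚ (suc n !) * T n k ≡ ℕ→ℚ (G n k)
factorial-T {n} {k} k≤n = begin
    ℕ→ℚ (suc n ℕ.* n !) * (c * (+ suc (n ∸ k) / suc n))
  ≡⟨ cong (_* (c * (+ suc (n ∸ k) / suc n))) (ℕ→ℚ-* (suc n) (n !)) ⟩
    (ℕ→ℚ (suc n) * f) * (c * (+ suc (n ∸ k) / suc n))
  ≡⟨ solve 4 (λ s f c q → (s :* f) :* (c :* q) := (f :* c) :* (s :* q)) refl (ℕ→ℚ (suc n)) f c _ ⟩
    (f * c) * (ℕ→ℚ (suc n) * (+ suc (n ∸ k) / suc n))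
  ≡⟨ cong ((f * c) *_) (ℕ→ℚ-cancel n (suc (n ∸ k))) ⟩
    (f * c) * ℕ→ℚ (suc (n ∸ k))
  ≡⟨ sym (trans (ℕ→ℚ-* (n ! ℕ.* ((n ℕ.+ k) C k)) _) (cong (_* ℕ→ℚ (suc (n ∸ k))) (ℕ→ℚ-* (n !) _))) ⟩
    ℕ→ℚ (n ! ℕ.* ((n ℕ.+ k) C k) ℕ.* suc (n ∸ k))
  ≡⟨ cong ℕ→ℚ (sym (G-in-range k≤n)) ⟩
    ℕ→ℚ (G n k) ∎
  where
  open ≡-Reasoning
  f = ℕ→ℚ (n !)
  c = ℕ→ℚ ((n ℕ.+ k) C k)

rhs-R : ∀ n → rhs n ≐ R n
rhs-R n = begin
    c · (m₀ ⊗ ΣP n f)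
  ≈⟨ ·-cong c (⊗-ΣP n m₀ f) ⟩
    c · ΣP n (λ k → m₀ ⊗ f k)
  ≈⟨ ·-ΣP n c (λ k → m₀ ⊗ f k) ⟩
    ΣP n (λ k → c · (m₀ ⊗ f k))
  ≈⟨ ΣP-cong-≤ n term ⟩
    R n ∎
  where
  open ≐-Reasoning
  c = ℕ→ℚ (suc n !)
  m₀ = mon 2 (2 ℕ.* n ℕ.+ 2) 0
  f : ℕ → Poly
  f k = T n k · mon (n ∸ k) 0 (2 ℕ.* k)
  term : ∀ k → k ≤ n → (c · (m₀ ⊗ f k)) ≐ (ℕ→ℚ (G n k) · mon (2 ℕ.+ (n ∸ k)) (2 ℕ.* n ℕ.+ 2) (2 ℕ.* k))
  term k k≤n = begin
      c · (m₀ ⊗ f k)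
    ≈⟨ ·-cong c (⊗-· m₀ (T n k) (mon (n ∸ k) 0 (2 ℕ.* k))) ⟩
      c · (T n k · (m₀ ⊗ mon (n ∸ k) 0 (2 ℕ.* k)))
    ≈⟨ ·-assoc c (T n k) _ ⟩
      (c * T n k) · (m₀ ⊗ mon (n ∸ k) 0 (2 ℕ.* k))
    ≈⟨ ·-cong (c * T n k) (≐-trans (mon-⊗ 2 (2 ℕ.* n ℕ.+ 2) 0 (n ∸ k) 0 (2 ℕ.* k))
         (mon-cong (refl {x = 2 ℕ.+ (n ∸ k)}) (ℕP.+-identityʳ (2 ℕ.* n ℕ.+ 2)) (refl {x = 2 ℕ.* k}))) ⟩
      (c * T n k) · mon (2 ℕ.+ (n ∸ k)) (2 ℕ.* n ℕ.+ 2) (2 ℕ.* k)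
    ≈⟨ ·-congˡ _ (factorial-T k≤n) ⟩
      ℕ→ℚ (G n k) · mon (2 ℕ.+ (n ∸ k)) (2 ℕ.* n ℕ.+ 2) (2 ℕ.* k) ∎

D^-R : ∀ n → D^ n (mon 2 2 0) ≐ R n
D^-R zero    i j k = sym (ℚP.*-identityˡ (mon 2 2 0 i j k))
D^-R (suc n) = ≐-trans (D-cong (D^-R n)) (D-R n)

theorem5 : (n : ℕ) → D^ n (mon 2 2 0) ≐ rhs n
theorem5 n = ≐-trans (D^-R n) (≐-sym (rhs-R n))
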